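{- Let $\Phi$ be a derivation in the CbNeed type system of $\Gamma\vdash^{(m,e)} t:M$ with $M\neq\mathbf 0$. (1) If $t\to_{m,\mathrm{need}} s$ then $m\geq 1$ and there is a derivation of $\Gamma\vdash^{(m-1,e)} s:M$. (2) If $t\to_{e,\mathrm{need}} s$ then $e\geq 1$ and there is a derivation of $\Gamma\vdash^{(m,e-1)} s:M$.
   Context: Terms: $t,s ::= x \mid \lambda x.t \mid t\,s \mid t[x\leftarrow s]$, where $t[x\leftarrow s]$ (explicit substitution) binds $x$ in $t$; values $v ::= \lambda x.t$; usual free variables, terms up to $\alpha$-equivalence. Contexts: substitution contexts $S ::= \langle\cdot\rangle \mid S[x\leftarrow t]$; CbNeed contexts $E ::= \langle\cdot\rangle \mid E\,t \mid E[x\leftarrow t] \mid E\langle\langle x\rangle\rangle[x\leftarrow E']$; $E\langle t\rangle$ plugging (may capture), $E\langle\langle t\rangle\rangle$ plugging where $E$ does not capture free variables of $t$. Root steps: $S\langle\lambda x.t\rangle s\mapsto_m S\langle t[x\leftarrow s]\rangle$ (variables bound by $S$ disjoint from $\mathrm{fv}(s)$); $E\langle\langle x\rangle\rangle[x\leftarrow S\langle v\rangle]\mapsto_e S\langle E\langle\langle v\rangle\rangle[x\leftarrow v]\rangle$ (variables bound by $S$ disjoint from $\mathrm{fv}(E\langle\langle x\rangle\rangle)$). $\to_{m,\mathrm{need}}$ (resp. $\to_{e,\mathrm{need}}$) relates $E\langle t'\rangle$ to $E\langle s'\rangle$ for any CbNeed context $E$ when $t'\mapsto_m s'$ (resp.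 $\mapsto_e$). CbNeed types: linear types $L ::= \mathsf{normal}\mid M\to N$; multi types $M,N ::= [L_i]_{i\in J}$ finite multisets, $\mathbf 0$ empty multiset, $\uplus$ union. Type contexts $\Gamma$ map variables to multi types, all but finitely many to $\mathbf 0$; $\mathrm{dom}(\Gamma)=\{x\mid\Gamma(x)\ne\mathbf 0\}$; $\uplus$ pointwise; $\Gamma,x:M$ means $\Gamma\uplus(x\mapsto M)$ with $x\notin\mathrm{dom}(\Gamma)$. Rules: (ax) $x:M\vdash^{(0,1)} x:M$ (with $M\neq\mathbf 0$); (normal) $\vdash^{(0,0)}\lambda x.t:\mathsf{normal}$; (fun) from $\Gamma,x:M\vdash^{(m,e)} t:N$ infer $\Gamma\vdash^{(m,e)}\lambda x.t:M\to N$; (many) from $\Gamma_i\vdash^{(m_i,e_i)}\lambda x.t:L_i$, $i\in J$, $J\neq\emptyset$, infer $\biguplus_i\Gamma_i\vdash^{(\sum m_i,\sum e_i)}\lambda x.t:[L_i]_{i\in J}$; (app$_{gc}$) from $\Gamma\vdash^{(m,e)} t:[\mathbf 0\to M]$ infer $\Gamma\vdash^{(m+1,e)} t\,s:M$; (app) from $\Gamma\vdash^{(m,e)} t:[N\to M]$ and $\Pi\vdash^{(m',e')} s:N$ with $N\ne\mathbf 0$ infer $\Gamma\uplus\Pi\vdash^{(m+m'+1,e+e')} t\,s:M$; (ES$_{gc}$) from $\Gamma\vdash^{(m,e)} t:M$ with $\Gamma(x)=\mathbf 0$ infer $\Gamma\vdash^{(m,e)} t[x\leftarrow s]:M$; (ES)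 from $\Gamma,x:N\vdash^{(m,e)} t:M$ and $\Pi\vdash^{(m',e')} s:N$ with $N\ne\mathbf 0$ infer $\Gamma\uplus\Pi\vdash^{(m+m',e+e')} t[x\leftarrow s]:M$. -}

module Defs where

open import Data.Nat using (ℕ; zero; suc; _+_; _<ᵇ_; _≡ᵇ_)
open import Data.Bool using (if_then_else_)
open import Data.List using (List; []; _∷_; _++_)
open import Relation.Binary.PropositionalEquality using (_≡_; _≢_)

-- Terms, in de Bruijn notation (terms up to α-equivalence).
--   var n   : variable
--   lam t   : λx.t        (t under one binder, x = index 0)
--   app t s : t s
--   es t s  : t[x←s]      (t under one binder, x = index 0; s is not)

data Term : Set where
  var : ℕ → Term
  lam : Term → Term
  app : Term → Term → Term
  es  : Term → Term → Term

wk : ℕ → ℕ → Term → Term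
wk d c (var n)   = var (if n <ᵇ c then n else n + d)
wk d c (lam t)   = lam (wk d (suc c) t)
wk d c (app t s) = app (wk d c t) (wk d c s)
wk d c (es t s)  = es (wk d (suc c) t) (wk d c s)

data SCtx : Set where
  hole : SCtx
  sES  : SCtx → Term → SCtx

plugS : SCtx → Term → Term
plugS hole      u = u
plugS (sES S t) u = es (plugS S u) t

bS : SCtx → ℕ
bS hole      = 0
bS (sES S t) = suc (bS S)

data ECtx : Set where
  hole  : ECtx
  eapp  : ECtx → Term → ECtx
  ees   : ECtx → Term → ECtx
  eneed : ECtx → ECtx → ECtx     -- eneed E E' = E⟨⟨x⟩⟩[x←E']

bE : ECtx → ℕ
bE hole          = 0
bE (eapp E t)    = bE E
bE (ees E t)     = suc (bE E)
bE (eneed E E')  = bE E'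

-- plugging E⟨u⟩ (may capture).  In eneed E E', the body is E⟨⟨x⟩⟩:
-- E plugged with the variable bound by the enclosing ES (not captured by E).
plugE : ECtx → Term → Term
plugE hole         u = u
plugE (eapp E t)   u = app (plugE E u) t
plugE (ees E t)    u = es (plugE E u) t
plugE (eneed E E') u = es (plugE E (var (bE E))) (plugE E' u)

wkE : ℕ → ℕ → ECtx → ECtx
wkE d c hole         = hole
wkE d c (eapp E t)   = eapp (wkE d c E) (wk d c t)
wkE d c (ees E t)    = ees (wkE d (suc c) E) (wk d c t)
wkE d c (eneed E E') = eneed (wkE d (suc c) E) (wkE d c E')

-- Root steps.
--  m:  S⟨λx.t⟩ s ↦ S⟨t[x←s]⟩   (s moved under the |S| binders of S)
--  e:  E⟨⟨x⟩⟩[x←S⟨v⟩] ↦ S⟨E⟨⟨v⟩⟩[x←v]⟩, v = λy.u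
--      (E moved under the binders of S; the copy of v moved under x and E)

data _↦m_ : Term → Term → Set where
  root-m : ∀ S t s →
    app (plugS S (lam t)) s ↦m plugS S (es t (wk (bS S) 0 s))

data _↦e_ : Term → Term → Set where
  root-e : ∀ E S u →
    es (plugE E (var (bE E))) (plugS S (lam u))
      ↦e plugS S (es (plugE (wkE (bS S) 1 E) (wk (suc (bE E)) 0 (lam u))) (lam u))

data _→m-need_ : Term → Term → Set where
  ctx-m : ∀ E {t s} → t ↦m s → plugE E t →m-need plugE E s

data _→e-need_ : Term → Term → Set where
  ctx-e : ∀ E {t s} → t ↦e s → plugE E t →e-need plugE E s

-- Types. Multi types are finite multisets, represented by lists taken
-- up to (nested) permutation ≈M.

data LType : Set where
  normal : LType
  _⇒_    : List LType → List LType → LType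

MType : Set
MType = List LType

𝟎 : MType
𝟎 = []

mutual
  data _≈L_ : LType → LType → Set where
    normal : normal ≈L normal
    _⇒_    : ∀ {M M' N N'} → M ≈M M' → N ≈M N' → (M ⇒ N) ≈L (M' ⇒ N')

  data _≈M_ : MType → MType → Set where
    []    : [] ≈M []
    _∷_   : ∀ {L L' M M'} → L ≈L L' → M ≈M M' → (L ∷ M) ≈M (L' ∷ M')
    swap  : ∀ L L' M → (L ∷ L' ∷ M) ≈M (L' ∷ L ∷ M)
    trans : ∀ {M N P} → M ≈M N → N ≈M P → M ≈M P

Ctx : Set
Ctx = ℕ → MType

∅ : Ctx
∅ _ = []

_⊎_ : Ctx → Ctx → Ctx
(Γ ⊎ Δ) n = Γ n ++ Δ n

_↦_ : ℕ → MType → Ctx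
(x ↦ M) n = if n ≡ᵇ x then M else []

-- Γ,x:M for the variable x bound by the binder (index 0); Γ describes
-- the outer variables, so x ∉ dom(Γ) automatically.
_◂_ : MType → Ctx → Ctx
(M ◂ Γ) zero    = M
(M ◂ Γ) (suc n) = Γ n

_≈C_ : Ctx → Ctx → Set
Γ ≈C Δ = ∀ n → Γ n ≈M Δ n

-- CbNeed type system with counters (m , e).
-- Judgements on multisets are represented by list judgements closed
-- under ≈ (rule conv), which changes neither term nor counters.

mutual
  data _⊢ₗ[_,_]_∶_ : Ctx → ℕ → ℕ → Term → LType → Set where
    normal : ∀ {t} → ∅ ⊢ₗ[ 0 , 0 ] lam t ∶ normal
    fun    : ∀ {Γ m e t M N} →
             (M ◂ Γ) ⊢[ m , e ] t ∶ N →
             Γ ⊢ₗ[ m , e ] lam t ∶ (M ⇒ N)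

  -- the family of premises of rule (many)
  data _⊢*[_,_]_∶_ : Ctx → ℕ → ℕ → Term → MType → Set where
    []  : ∀ {t} → ∅ ⊢*[ 0 , 0 ] t ∶ []
    _∷_ : ∀ {Γ Δ m e m' e' t L Ls} →
          Γ ⊢ₗ[ m , e ] t ∶ L → Δ ⊢*[ m' , e' ] t ∶ Ls →
          (Γ ⊎ Δ) ⊢*[ m + m' , e + e' ] t ∶ (L ∷ Ls)

  data _⊢[_,_]_∶_ : Ctx → ℕ → ℕ → Term → MType → Set where
    ax     : ∀ {x M} → M ≢ 𝟎 → (x ↦ M) ⊢[ 0 , 1 ] var x ∶ M
    many   : ∀ {Γ m e t Ls} → Ls ≢ [] →
             Γ ⊢*[ m , e ] lam t ∶ Ls → Γ ⊢[ m , e ] lam t ∶ Ls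
    app-gc : ∀ {Γ m e t s M} →
             Γ ⊢[ m , e ] t ∶ ((𝟎 ⇒ M) ∷ []) →
             Γ ⊢[ suc m , e ] app t s ∶ M
    app    : ∀ {Γ Π m e m' e' t s M N} →
             Γ ⊢[ m , e ] t ∶ ((N ⇒ M) ∷ []) → Π ⊢[ m' , e' ] s ∶ N → N ≢ 𝟎 →
             (Γ ⊎ Π) ⊢[ suc (m + m') , e + e' ] app t s ∶ M
    es-gc  : ∀ {Γ m e t s M} →
             (𝟎 ◂ Γ) ⊢[ m , e ] t ∶ M →
             Γ ⊢[ m , e ] es t s ∶ M
    es     : ∀ {Γ Π m e m' e' t s M N} →
             (N ◂ Γ) ⊢[ m , e ] t ∶ M → Π ⊢[ m' , e' ] s ∶ N → N ≢ 𝟎 →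
             (Γ ⊎ Π) ⊢[ m + m' , e + e' ] es t s ∶ M
    conv   : ∀ {Γ Γ' m e t M M'} →
             Γ ⊢[ m , e ] t ∶ M → Γ ≈C Γ' → M ≈M M' →
             Γ' ⊢[ m , e ] t ∶ M'

module Submission where

-- (1) Multi-type equivalence ≈M makes union a commutative monoid; type contexts
--     are compared pointwise.  (2) Weakening: shifting a term corresponds to
--     inserting empty slots in its context, with unchanged counters.
-- (3) Inversion for variables, abstractions, applications and explicit
--     substitutions; arguments of the last two are uniformly "erased or typed".
-- (4) A derivation of C⟨u⟩ decomposes along C into a derivation of u, the rest
--     of the context and counters, and a way to refill the hole; proved layer
--     by layer for substitution contexts and for CbNeed contexts (whose hole
--     then has a non-𝟎 type, so the needed variable is never erased).
-- (5) Root steps: β under S consumes the (app) rule, i.e. one m; the e-step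
--     splits the type of the value between the needed occurrence, which loses
--     its axiom (one e), and the new substitution.
-- (6) The theorem: decompose along E, reduce at the hole, refill.

open import Defs
open import Data.Nat using (ℕ; zero; suc; _+_; _<ᵇ_; _≡ᵇ_; _<_; _≤_; _∸_; z≤n; s≤s)
open import Data.Nat.Properties using (+-identityʳ; +-suc; +-assoc; +-comm; ≤-refl; ≤-reflexive; m≤n⇒m≤1+n; <⇒≢; m+1+n≢m; <⇒<ᵇ; <ᵇ⇒<; <-≤-trans; m≤m+n; ≡⇒≡ᵇ; ≡ᵇ⇒≡)
open import Data.Nat.Tactic.RingSolver using (solve-∀)
open import Data.Bool using (true; false; if_then_else_; T)
open import Data.List using ([]; _∷_; _++_; length)
open import Data.List.Properties using (++-assoc; ++-identityʳ)
open import Data.Product using (Σ; _×_; _,_; proj₂)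
open import Data.Empty using (⊥; ⊥-elim)
open import Relation.Binary.PropositionalEquality using (_≡_; _≢_; refl; sym; cong; cong₂; subst; subst₂)
import Relation.Binary.PropositionalEquality as Eq

mutual
  ≈L-refl : ∀ L → L ≈L L
  ≈L-refl normal  = normal
  ≈L-refl (M ⇒ N) = ≈M-refl M ⇒ ≈M-refl N

  ≈M-refl : ∀ M → M ≈M M
  ≈M-refl []      = []
  ≈M-refl (L ∷ M) = ≈L-refl L ∷ ≈M-refl M

mutual
  ≈L-sym : ∀ {L L'} → L ≈L L' → L' ≈L L
  ≈L-sym normal  = normal
  ≈L-sym (p ⇒ q) = ≈M-sym p ⇒ ≈M-sym q

  ≈M-sym : ∀ {M M'} → M ≈M M' → M' ≈M M
  ≈M-sym []            = []
  ≈M-sym (p ∷ q)       = ≈L-sym p ∷ ≈M-sym q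
  ≈M-sym (swap L L' M) = swap L' L M
  ≈M-sym (trans p q)   = trans (≈M-sym q) (≈M-sym p)

≈L-trans : ∀ {L L' L''} → L ≈L L' → L' ≈L L'' → L ≈L L''
≈L-trans normal  normal  = normal
≈L-trans (p ⇒ q) (r ⇒ s) = trans p r ⇒ trans q s

_⟫_ : ∀ {M N P} → M ≈M N → N ≈M P → M ≈M P
_⟫_ = trans
infixr 5 _⟫_

≡⇒≈M : ∀ {M N} → M ≡ N → M ≈M N
≡⇒≈M {M} refl = ≈M-refl M

≈M-length : ∀ {M N} → M ≈M N → length M ≡ length N
≈M-length []            = refl
≈M-length (_ ∷ q)       = cong suc (≈M-length q)
≈M-length (swap _ _ _)  = refl
≈M-length (trans p q)   = Eq.trans (≈M-length p) (≈M-length q)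

≈𝟎⇒≡𝟎 : ∀ {M} → M ≈M 𝟎 → M ≡ 𝟎
≈𝟎⇒≡𝟎 {[]}    _ = refl
≈𝟎⇒≡𝟎 {_ ∷ _} p with ≈M-length p
... | ()

𝟎≈++ : ∀ {A B : MType} → 𝟎 ≈M (A ++ B) → A ≡ 𝟎 × B ≡ 𝟎
𝟎≈++ {A} {B} p with A | B | ≈𝟎⇒≡𝟎 (≈M-sym p)
... | [] | [] | refl = refl , refl

≈-singleton : ∀ {M L} → M ≈M (L ∷ []) → Σ LType λ L' → M ≡ L' ∷ [] × L' ≈L L
≈-singleton (p ∷ q) with ≈𝟎⇒≡𝟎 q
... | refl = _ , refl , p
≈-singleton (trans p q) with ≈-singleton q
... | _ , refl , r with ≈-singleton p
... | L' , refl , r' = L' , refl , ≈L-trans r' r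

++-≈ˡ : ∀ {M M'} N → M ≈M M' → (M ++ N) ≈M (M' ++ N)
++-≈ˡ N []            = ≈M-refl N
++-≈ˡ N (p ∷ q)       = p ∷ ++-≈ˡ N q
++-≈ˡ N (swap L L' M) = swap L L' (M ++ N)
++-≈ˡ N (trans p q)   = ++-≈ˡ N p ⟫ ++-≈ˡ N q

++-≈ʳ : ∀ M {N N'} → N ≈M N' → (M ++ N) ≈M (M ++ N')
++-≈ʳ []      p = p
++-≈ʳ (L ∷ M) p = ≈L-refl L ∷ ++-≈ʳ M p

++-≈ : ∀ {M M' N N'} → M ≈M M' → N ≈M N' → (M ++ N) ≈M (M' ++ N')
++-≈ {M' = M'} {N} p q = ++-≈ˡ N p ⟫ ++-≈ʳ M' q

++-assoc-≈ : ∀ A B C → ((A ++ B) ++ C) ≈M (A ++ (B ++ C))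
++-assoc-≈ A B C = ≡⇒≈M (++-assoc A B C)

++-comm-≈ : ∀ M N → (M ++ N) ≈M (N ++ M)
++-comm-≈ []      N = ≡⇒≈M (sym (++-identityʳ N))
++-comm-≈ (L ∷ M) N = (≈L-refl L ∷ ++-comm-≈ M N) ⟫ ≈M-sym (move L N M)
  where
  move : ∀ L M N → (M ++ L ∷ N) ≈M (L ∷ (M ++ N))
  move L []      N = ≈M-refl (L ∷ N)
  move L (x ∷ M) N = (≈L-refl x ∷ move L M N) ⟫ swap x L (M ++ N)

++-exchange : ∀ X Y Z → (X ++ (Y ++ Z)) ≈M (Y ++ (X ++ Z))
++-exchange X Y Z = ≈M-sym (++-assoc-≈ X Y Z) ⟫ ++-≈ˡ Z (++-comm-≈ X Y) ⟫ ++-assoc-≈ Y X Z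

++-middle-swap : ∀ X Y Z → ((X ++ Y) ++ Z) ≈M ((X ++ Z) ++ Y)
++-middle-swap X Y Z = ++-assoc-≈ X Y Z ⟫ ++-≈ʳ X (++-comm-≈ Y Z) ⟫ ≈M-sym (++-assoc-≈ X Z Y)

≈C-refl : ∀ {Γ} → Γ ≈C Γ
≈C-refl {Γ} n = ≈M-refl (Γ n)

≈C-sym : ∀ {Γ Δ} → Γ ≈C Δ → Δ ≈C Γ
≈C-sym p n = ≈M-sym (p n)

≈C-trans : ∀ {Γ Δ Θ} → Γ ≈C Δ → Δ ≈C Θ → Γ ≈C Θ
≈C-trans p q n = p n ⟫ q n

⊎-≈C : ∀ {Γ Γ' Δ Δ'} → Γ ≈C Γ' → Δ ≈C Δ' → (Γ ⊎ Δ) ≈C (Γ' ⊎ Δ')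
⊎-≈C p q n = ++-≈ (p n) (q n)

◂-≈C : ∀ {A A' Γ Γ'} → A ≈M A' → Γ ≈C Γ' → (A ◂ Γ) ≈C (A' ◂ Γ')
◂-≈C p q zero    = p
◂-≈C p q (suc n) = q n

at : ∀ (Θ : Ctx) {i j} → i ≡ j → Θ i ≈M Θ j
at Θ {i} refl = ≈M-refl (Θ i)

↦-≈C : ∀ x {N N'} → N ≈M N' → (x ↦ N) ≈C (x ↦ N')
↦-≈C x p n with n ≡ᵇ x
... | true  = p
... | false = []

↦-self : ∀ x N → (x ↦ N) x ≡ N
↦-self x N with x ≡ᵇ x in eq
... | true  = refl
... | false = ⊥-elim (subst T eq (≡⇒≡ᵇ x x refl))

↦-other : ∀ x N n → n ≢ x → (x ↦ N) n ≡ 𝟎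
↦-other x N n n≢x with n ≡ᵇ x in eq
... | true  = ⊥-elim (n≢x (≡ᵇ⇒≡ n x (subst T (sym eq) _)))
... | false = refl

-- the context Δ without its first b entries (those of variables bound by a context)
dropC : ℕ → Ctx → Ctx
dropC b Δ k = Δ (b + k)

wk-zero : ∀ c t → wk 0 c t ≡ t
wk-zero c (var n) with n <ᵇ c
... | true  = refl
... | false = cong var (+-identityʳ n)
wk-zero c (lam t)   = cong lam (wk-zero (suc c) t)
wk-zero c (app t s) = cong₂ app (wk-zero c t) (wk-zero c s)
wk-zero c (es t s)  = cong₂ es (wk-zero (suc c) t) (wk-zero c s)

<ᵇ-false-+ : ∀ n d c → (n <ᵇ c) ≡ false → ((n + d) <ᵇ c) ≡ false
<ᵇ-false-+ n d c eq with (n + d) <ᵇ c in eq'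
... | false = refl
... | true  = ⊥-elim (subst T eq (<⇒<ᵇ (<-≤-trans (s≤s (m≤m+n n d)) (<ᵇ⇒< (n + d) c (subst T (sym eq') _)))))

wk-suc : ∀ d c t → wk 1 c (wk d c t) ≡ wk (suc d) c t
wk-suc d c (var n) with n <ᵇ c in eq
... | true  rewrite eq = refl
... | false rewrite <ᵇ-false-+ n d c eq = cong var (Eq.trans (+-assoc n d 1) (cong (n +_) (+-comm d 1)))
wk-suc d c (lam t)   = cong lam (wk-suc d (suc c) t)
wk-suc d c (app t s) = cong₂ app (wk-suc d c t) (wk-suc d c s)
wk-suc d c (es t s)  = cong₂ es (wk-suc d (suc c) t) (wk-suc d c s)

bE-wkE : ∀ d c E → bE (wkE d c E) ≡ bE E
bE-wkE d c hole         = refl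
bE-wkE d c (eapp E t)   = bE-wkE d c E
bE-wkE d c (ees E t)    = cong suc (bE-wkE d (suc c) E)
bE-wkE d c (eneed E E') = bE-wkE d c E'

var-below-cutoff : ∀ d c n → wk d (suc (c + n)) (var n) ≡ var n
var-below-cutoff d c n with n <ᵇ suc (c + n) in eq
... | true  = refl
... | false = ⊥-elim (subst T eq (<⇒<ᵇ (s≤s (subst (n ≤_) (+-comm n c) (m≤m+n n c)))))

wk-plugE : ∀ d c E w → wk d c (plugE E w) ≡ plugE (wkE d c E) (wk d (c + bE E) w)
wk-plugE d c hole w = cong (λ z → wk d z w) (sym (+-identityʳ c))
wk-plugE d c (eapp E t) w = cong (λ z → app z (wk d c t)) (wk-plugE d c E w)
wk-plugE d c (ees E t) w =
  cong (λ z → es z (wk d c t))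
    (Eq.trans (wk-plugE d (suc c) E w) (cong (λ z → plugE (wkE d (suc c) E) (wk d z w)) (sym (+-suc c (bE E)))))
wk-plugE d c (eneed E E') w =
  cong₂ es (Eq.trans (wk-plugE d (suc c) E (var (bE E)))
                     (cong (plugE (wkE d (suc c) E))
                           (Eq.trans (var-below-cutoff d c (bE E)) (cong var (sym (bE-wkE d (suc c) E))))))
           (wk-plugE d c E' w)

wk-need-body : ∀ d E → wk d 1 (plugE E (var (bE E))) ≡ plugE (wkE d 1 E) (var (bE (wkE d 1 E)))
wk-need-body d E =
  Eq.trans (wk-plugE d 1 E (var (bE E)))
           (cong (plugE (wkE d 1 E)) (Eq.trans (var-below-cutoff d 0 (bE E)) (cong var (sym (bE-wkE d 1 E)))))

insert𝟎 : ℕ → Ctx → Ctx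
insert𝟎 zero    Γ = 𝟎 ◂ Γ
insert𝟎 (suc c) Γ = Γ zero ◂ insert𝟎 c (λ n → Γ (suc n))

pad : ℕ → ℕ → Ctx → Ctx
pad zero    c Γ = Γ
pad (suc d) c Γ = insert𝟎 c (pad d c Γ)

insert𝟎-≈C : ∀ c {Γ Γ'} → Γ ≈C Γ' → insert𝟎 c Γ ≈C insert𝟎 c Γ'
insert𝟎-≈C zero    p zero    = []
insert𝟎-≈C zero    p (suc n) = p n
insert𝟎-≈C (suc c) p zero    = p zero
insert𝟎-≈C (suc c) p (suc n) = insert𝟎-≈C c (λ k → p (suc k)) n

insert𝟎-∅ : ∀ c n → insert𝟎 c ∅ n ≡ 𝟎
insert𝟎-∅ zero    zero    = refl
insert𝟎-∅ zero    (suc n) = refl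
insert𝟎-∅ (suc c) zero    = refl
insert𝟎-∅ (suc c) (suc n) = insert𝟎-∅ c n

insert𝟎-⊎ : ∀ c Γ Δ n → insert𝟎 c (Γ ⊎ Δ) n ≡ (insert𝟎 c Γ ⊎ insert𝟎 c Δ) n
insert𝟎-⊎ zero    Γ Δ zero    = refl
insert𝟎-⊎ zero    Γ Δ (suc n) = refl
insert𝟎-⊎ (suc c) Γ Δ zero    = refl
insert𝟎-⊎ (suc c) Γ Δ (suc n) = insert𝟎-⊎ c (λ k → Γ (suc k)) (λ k → Δ (suc k)) n

shifted : ℕ → ℕ → ℕ
shifted c x = if x <ᵇ c then x else suc x

wk1-var : ∀ c x → wk 1 c (var x) ≡ var (shifted c x)
wk1-var c x with x <ᵇ c
... | true  = refl
... | false = cong var (+-comm x 1)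

insert𝟎-↦ : ∀ c x M n → insert𝟎 c (x ↦ M) n ≡ (shifted c x ↦ M) n
insert𝟎-↦ zero    x       M zero    = refl
insert𝟎-↦ zero    x       M (suc n) = refl
insert𝟎-↦ (suc c) zero    M zero    = refl
insert𝟎-↦ (suc c) zero    M (suc n) = insert𝟎-∅ c n
insert𝟎-↦ (suc c) (suc x) M n with x <ᵇ c | insert𝟎-↦ c x M
insert𝟎-↦ (suc c) (suc x) M zero    | true  | ih = refl
insert𝟎-↦ (suc c) (suc x) M (suc n) | true  | ih = ih n
insert𝟎-↦ (suc c) (suc x) M zero    | false | ih = refl
insert𝟎-↦ (suc c) (suc x) M (suc n) | false | ih = ih n

-- Weakening: typing is stable under inserting an unused variable, with the
-- same counters.  Linear and family judgements have a context only up to ≈C.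

mutual
  weaken1 : ∀ c {Γ m e t M} → Γ ⊢[ m , e ] t ∶ M → insert𝟎 c Γ ⊢[ m , e ] wk 1 c t ∶ M
  weaken1 c {M = M} (ax {x} M≢𝟎) =
    subst (λ z → insert𝟎 c (x ↦ M) ⊢[ 0 , 1 ] z ∶ M) (sym (wk1-var c x))
      (conv (ax M≢𝟎) (λ n → ≡⇒≈M (sym (insert𝟎-↦ c x M n))) (≈M-refl M))
  weaken1 c {M = M} (many Ls≢[] ds) with weaken1* c ds
  ... | Γ' , Γ'≈ , ds' = conv (many Ls≢[] ds') Γ'≈ (≈M-refl M)
  weaken1 c (app-gc D) = app-gc (weaken1 c D)
  weaken1 c {M = M} (app {Γ} {Π} D P N≢𝟎) =
    conv (app (weaken1 c D) (weaken1 c P) N≢𝟎) (λ n → ≡⇒≈M (sym (insert𝟎-⊎ c Γ Π n))) (≈M-refl M)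
  weaken1 c (es-gc D) = es-gc (weaken1 (suc c) D)
  weaken1 c {M = M} (es {Γ} {Π} D P N≢𝟎) =
    conv (es (weaken1 (suc c) D) (weaken1 c P) N≢𝟎) (λ n → ≡⇒≈M (sym (insert𝟎-⊎ c Γ Π n))) (≈M-refl M)
  weaken1 c (conv D p q) = conv (weaken1 c D) (insert𝟎-≈C c p) q

  weaken1ₗ : ∀ c {Γ m e t L} → Γ ⊢ₗ[ m , e ] t ∶ L →
             Σ Ctx λ Γ' → Γ' ≈C insert𝟎 c Γ × Γ' ⊢ₗ[ m , e ] wk 1 c t ∶ L
  weaken1ₗ c normal  = ∅ , (λ n → ≡⇒≈M (sym (insert𝟎-∅ c n))) , normal
  weaken1ₗ c (fun D) = _ , ≈C-refl , fun (weaken1 (suc c) D)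

  weaken1* : ∀ c {Γ m e t Ls} → Γ ⊢*[ m , e ] t ∶ Ls →
             Σ Ctx λ Γ' → Γ' ≈C insert𝟎 c Γ × Γ' ⊢*[ m , e ] wk 1 c t ∶ Ls
  weaken1* c [] = ∅ , (λ n → ≡⇒≈M (sym (insert𝟎-∅ c n))) , []
  weaken1* c (_∷_ {Γ} {Δ} d ds) with weaken1ₗ c d | weaken1* c ds
  ... | Γ₁ , p₁ , d' | Γ₂ , p₂ , ds' =
    Γ₁ ⊎ Γ₂ , ≈C-trans (⊎-≈C p₁ p₂) (λ n → ≡⇒≈M (sym (insert𝟎-⊎ c Γ Δ n))) , d' ∷ ds'

weaken : ∀ d c {Γ m e t M} → Γ ⊢[ m , e ] t ∶ M → pad d c Γ ⊢[ m , e ] wk d c t ∶ M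
weaken zero    c {t = t} D = subst (λ z → _ ⊢[ _ , _ ] z ∶ _) (sym (wk-zero c t)) D
weaken (suc d) c {t = t} D = subst (λ z → _ ⊢[ _ , _ ] z ∶ _) (wk-suc d c t) (weaken1 c (weaken d c D))

pad-above-◂ : ∀ d K Γ → pad d 1 (K ◂ Γ) ≡ (K ◂ pad d 0 Γ)
pad-above-◂ zero    K Γ = refl
pad-above-◂ (suc d) K Γ rewrite pad-above-◂ d K Γ = refl

pad-below : ∀ d Γ k → k < d → pad d 0 Γ k ≡ 𝟎
pad-below (suc d) Γ zero    _         = refl
pad-below (suc d) Γ (suc k) (s≤s k<d) = pad-below d Γ k k<d

pad-above : ∀ d Γ k → pad d 0 Γ (d + k) ≡ Γ k
pad-above zero    Γ k = refl
pad-above (suc d) Γ k = pad-above d Γ k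

pad-empty : ∀ d Γ → (∀ k → Γ k ≡ 𝟎) → ∀ k → pad d 0 Γ k ≡ 𝟎
pad-empty zero    Γ Γ≡𝟎 k       = Γ≡𝟎 k
pad-empty (suc d) Γ Γ≡𝟎 zero    = refl
pad-empty (suc d) Γ Γ≡𝟎 (suc k) = pad-empty d Γ Γ≡𝟎 k

castD : ∀ {Γ m e m' e' t M} → m ≡ m' → e ≡ e' → Γ ⊢[ m , e ] t ∶ M → Γ ⊢[ m' , e' ] t ∶ M
castD refl refl D = D

castD* : ∀ {Γ m e m' e' t M} → m ≡ m' → e ≡ e' → Γ ⊢*[ m , e ] t ∶ M → Γ ⊢*[ m' , e' ] t ∶ M
castD* refl refl ds = ds

convC : ∀ {Γ Γ' m e t M} → Γ ⊢[ m , e ] t ∶ M → Γ ≈C Γ' → Γ' ⊢[ m , e ] t ∶ M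
convC {M = M} D p = conv D p (≈M-refl M)

⊎-𝟎 : ∀ Γ {Π} → (∀ k → Π k ≡ 𝟎) → (Γ ⊎ Π) ≈C Γ
⊎-𝟎 Γ {Π} Π≡𝟎 k = ≡⇒≈M (Eq.trans (cong (Γ k ++_) (Π≡𝟎 k)) (++-identityʳ (Γ k)))

var-inversion : ∀ {Δ m e x N} → Δ ⊢[ m , e ] var x ∶ N → m ≡ 0 × e ≡ 1 × Δ ≈C (x ↦ N)
var-inversion (ax _) = refl , refl , ≈C-refl
var-inversion {x = x} (conv D p q) with var-inversion D
... | m≡0 , e≡1 , Δ≈ = m≡0 , e≡1 , ≈C-trans (≈C-sym p) (≈C-trans Δ≈ (↦-≈C x q))

-- Arguments of applications and explicit substitutions are either erased
-- (rules app_gc, ES_gc: type 𝟎, no counters, empty context) or typed by a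
-- non-𝟎 multi type.  This lets one treat the two variants of each rule at once.
data Arg : Ctx → ℕ → ℕ → Term → MType → Set where
  erased : ∀ {Π s} → (∀ k → Π k ≡ 𝟎) → Arg Π 0 0 s 𝟎
  typed  : ∀ {Π m e s N} → N ≢ 𝟎 → Π ⊢[ m , e ] s ∶ N → Arg Π m e s N

app-arg : ∀ {Γ Π m e m' e' t s N M} → Γ ⊢[ m , e ] t ∶ ((N ⇒ M) ∷ []) → Arg Π m' e' s N →
          (Γ ⊎ Π) ⊢[ suc (m + m') , e + e' ] app t s ∶ M
app-arg {Γ} {m = m} {e} D (erased Π≡𝟎) =
  castD (cong suc (sym (+-identityʳ m))) (sym (+-identityʳ e)) (convC (app-gc D) (≈C-sym (⊎-𝟎 Γ Π≡𝟎)))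
app-arg D (typed N≢𝟎 P) = app D P N≢𝟎

es-arg : ∀ {Γ Π m e m' e' t s N M} → (N ◂ Γ) ⊢[ m , e ] t ∶ M → Arg Π m' e' s N →
         (Γ ⊎ Π) ⊢[ m + m' , e + e' ] es t s ∶ M
es-arg {Γ} {m = m} {e} D (erased Π≡𝟎) =
  castD (sym (+-identityʳ m)) (sym (+-identityʳ e)) (convC (es-gc D) (≈C-sym (⊎-𝟎 Γ Π≡𝟎)))
es-arg D (typed N≢𝟎 P) = es D P N≢𝟎

weaken-arg : ∀ d {Π m e s N} → Arg Π m e s N → Arg (pad d 0 Π) m e (wk d 0 s) N
weaken-arg d {Π} (erased Π≡𝟎)  = erased (pad-empty d Π Π≡𝟎)
weaken-arg d (typed N≢𝟎 P) = typed N≢𝟎 (weaken d 0 P)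

family-arg : ∀ {Π m e u A} → Π ⊢*[ m , e ] lam u ∶ A → Arg Π m e (lam u) A
family-arg []       = erased (λ _ → refl)
family-arg (d ∷ ds) = typed (λ ()) (many (λ ()) (d ∷ ds))

-- Inversion of application and explicit substitution: the premises of the
-- rule that introduced app t s (resp. t[x←s]), after pushing conversions up.

record AppView (Γ : Ctx) (m e : ℕ) (t s : Term) (M : MType) : Set where
  field
    Γt Πs : Ctx
    N     : MType
    mt et ms es′ : ℕ
    head  : Γt ⊢[ mt , et ] t ∶ ((N ⇒ M) ∷ [])
    arg   : Arg Πs ms es′ s N
    ctx≈  : Γ ≈C (Γt ⊎ Πs)
    m≡    : m ≡ suc (mt + ms)
    e≡    : e ≡ et + es′

app-view : ∀ {Γ m e t s M} → Γ ⊢[ m , e ] app t s ∶ M → AppView Γ m e t s M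
app-view {Γ} {suc m} {e} (app-gc D) = record
  { head = D ; arg = erased {Π = ∅} (λ _ → refl) ; ctx≈ = ≈C-sym (⊎-𝟎 Γ (λ _ → refl))
  ; m≡ = cong suc (sym (+-identityʳ m)) ; e≡ = sym (+-identityʳ e) }
app-view (app D P N≢𝟎) = record
  { head = D ; arg = typed N≢𝟎 P ; ctx≈ = ≈C-refl ; m≡ = refl ; e≡ = refl }
app-view (conv D p q) = record
  { head = conv head ≈C-refl ((≈M-refl N ⇒ q) ∷ []) ; arg = arg
  ; ctx≈ = ≈C-trans (≈C-sym p) ctx≈ ; m≡ = m≡ ; e≡ = e≡ }
  where open AppView (app-view D)

record ESView (Γ : Ctx) (m e : ℕ) (t s : Term) (M : MType) : Set where
  field
    Γt Πs : Ctx
    N     : MType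
    mt et ms es′ : ℕ
    body  : (N ◂ Γt) ⊢[ mt , et ] t ∶ M
    arg   : Arg Πs ms es′ s N
    ctx≈  : Γ ≈C (Γt ⊎ Πs)
    m≡    : m ≡ mt + ms
    e≡    : e ≡ et + es′

es-view : ∀ {Γ m e t s M} → Γ ⊢[ m , e ] es t s ∶ M → ESView Γ m e t s M
es-view {Γ} {m} {e} (es-gc D) = record
  { body = D ; arg = erased {Π = ∅} (λ _ → refl) ; ctx≈ = ≈C-sym (⊎-𝟎 Γ (λ _ → refl))
  ; m≡ = sym (+-identityʳ m) ; e≡ = sym (+-identityʳ e) }
es-view (es D P N≢𝟎) = record
  { body = D ; arg = typed N≢𝟎 P ; ctx≈ = ≈C-refl ; m≡ = refl ; e≡ = refl }
es-view (conv D p q) = record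
  { body = conv body ≈C-refl q ; arg = arg ; ctx≈ = ≈C-trans (≈C-sym p) ctx≈ ; m≡ = m≡ ; e≡ = e≡ }
  where open ESView (es-view D)

convL : ∀ {Γ m e t L L'} → Γ ⊢ₗ[ m , e ] t ∶ L → L ≈L L' → Γ ⊢ₗ[ m , e ] t ∶ L'
convL normal  normal  = normal
convL (fun D) (p ⇒ q) = fun (conv D (◂-≈C p ≈C-refl) q)

arrow-inversion : ∀ {Γ m e t T N M} → Γ ⊢[ m , e ] lam t ∶ T → T ≈M ((N ⇒ M) ∷ []) →
                  (N ◂ Γ) ⊢[ m , e ] t ∶ M
arrow-inversion (many Ls≢[] []) p = ⊥-elim (Ls≢[] refl)
arrow-inversion (many _ (_ ∷ _ ∷ _)) p with ≈-singleton p
... | _ , () , _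
arrow-inversion (many _ (normal ∷ [])) p with ≈-singleton p
... | _ , refl , ()
arrow-inversion (many _ (_∷_ {Γ = Γ₀} (fun D) [])) p with ≈-singleton p
... | _ , refl , (N≈ ⇒ M≈) =
  castD (sym (+-identityʳ _)) (sym (+-identityʳ _))
    (conv D (◂-≈C N≈ (λ n → ≡⇒≈M (sym (++-identityʳ (Γ₀ n))))) M≈)
arrow-inversion (conv D c q) p = convC (arrow-inversion D (q ⟫ p)) (◂-≈C (≈M-refl _) c)

as-family : ∀ {Γ m e u K} → Γ ⊢[ m , e ] lam u ∶ K →
  Σ Ctx λ Γ' → Σ MType λ K' → Γ ≈C Γ' × K ≈M K' × Γ' ⊢*[ m , e ] lam u ∶ K'
as-family (many _ ds) = _ , _ , ≈C-refl , ≈M-refl _ , ds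
as-family (conv D c q) with as-family D
... | Γ' , K' , c' , q' , ds = Γ' , K' , ≈C-trans (≈C-sym c) c' , ≈M-sym q ⟫ q' , ds

family-≈ : ∀ {Γ m e t K K'} → Γ ⊢*[ m , e ] t ∶ K → K ≈M K' →
  Σ Ctx λ Γ' → Γ ≈C Γ' × Γ' ⊢*[ m , e ] t ∶ K'
family-≈ [] [] = ∅ , ≈C-refl , []
family-≈ (d ∷ ds) (p ∷ q) with family-≈ ds q
... | Γ' , c , ds' = _ , ⊎-≈C ≈C-refl c , convL d p ∷ ds'
family-≈ (_∷_ {Γ = Γ₁} {m = m₁} {e = e₁} d (_∷_ {Γ = Γ₂} {Δ = Γ₃} {m = m₂} {e = e₂} {m' = m₃} {e' = e₃} d' ds))
         (swap _ _ _) =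
  _ , (λ n → ++-exchange (Γ₁ n) (Γ₂ n) (Γ₃ n)) , castD* (exchange m₁ m₂ m₃) (exchange e₁ e₂ e₃) (d' ∷ (d ∷ ds))
  where
  exchange : ∀ a b c → b + (a + c) ≡ a + (b + c)
  exchange = solve-∀
family-≈ ds (trans p q) with family-≈ ds p
... | Γ' , c , ds' with family-≈ ds' q
... | Γ'' , c' , ds'' = Γ'' , ≈C-trans c c' , ds''

record FamilySplit (Γ : Ctx) (m e : ℕ) (t : Term) (A B : MType) : Set where
  field
    ΓA ΓB : Ctx
    mA eA mB eB : ℕ
    left  : ΓA ⊢*[ mA , eA ] t ∶ A
    right : ΓB ⊢*[ mB , eB ] t ∶ B
    ctx≈  : Γ ≈C (ΓA ⊎ ΓB)
    m≡    : m ≡ mA + mB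
    e≡    : e ≡ eA + eB

family-split : ∀ A {B Γ m e t} → Γ ⊢*[ m , e ] t ∶ (A ++ B) → FamilySplit Γ m e t A B
family-split [] ds = record { left = [] ; right = ds ; ctx≈ = ≈C-refl ; m≡ = refl ; e≡ = refl }
family-split (L ∷ A) (_∷_ {Γ = Γ₁} {m = m₁} {e = e₁} d ds) = record
  { left = d ∷ left ; right = right
  ; ctx≈ = λ n → ++-≈ʳ (Γ₁ n) (ctx≈ n) ⟫ ≈M-sym (++-assoc-≈ (Γ₁ n) (ΓA n) (ΓB n))
  ; m≡ = Eq.trans (cong (m₁ +_) m≡) (sym (+-assoc m₁ mA mB))
  ; e≡ = Eq.trans (cong (e₁ +_) e≡) (sym (+-assoc e₁ eA eB)) }
  where open FamilySplit (family-split A ds)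

lam-split : ∀ {Γ m e u K} A B → Γ ⊢[ m , e ] lam u ∶ K → K ≈M (A ++ B) → FamilySplit Γ m e (lam u) A B
lam-split A B D K≈ with as-family D
... | Γ' , K' , c , q , ds with family-≈ ds (≈M-sym q ⟫ K≈)
... | Γ'' , c' , ds' = record
  { left = left ; right = right ; ctx≈ = ≈C-trans c (≈C-trans c' ctx≈) ; m≡ = m≡ ; e≡ = e≡ }
  where open FamilySplit (family-split A ds')

-- Decomposition of a derivation for C⟨u⟩ along a context C whose hole is under
-- b binders: a derivation for the plugged term u (of type N, context Δ, whose
-- first b variables are those bound by C), the rest Γout of the context and of
-- the counters, and the ability to refill the hole with any term of type N',
-- whose context agrees with Δ on the b captured variables, giving type M'.
-- For CbNeed contexts N' = N and M' is the type of C⟨u⟩; substitution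
-- contexts are transparent to types, so for them any N' = M' will do.
record Decomposition (Γ : Ctx) (m e b : ℕ) (C : Term → Term) (u : Term) (N N' M' : MType) : Set where
  field
    Γout Δ : Ctx
    mu eu mC eC : ℕ
    inner  : Δ ⊢[ mu , eu ] u ∶ N
    m≡     : m ≡ mu + mC
    e≡     : e ≡ eu + eC
    ctx≈   : Γ ≈C (Γout ⊎ dropC b Δ)
    refill : ∀ {Δ' m' e' u'} → (∀ k → k < b → Δ' k ≈M Δ k) → Δ' ⊢[ m' , e' ] u' ∶ N' →
             (Γout ⊎ dropC b Δ') ⊢[ m' + mC , e' + eC ] C u' ∶ M'

retarget : ∀ {Γ Γ' m m' e e' b C u N N' M'} → Γ ≈C Γ' → m ≡ m' → e ≡ e' →
           Decomposition Γ' m' e' b C u N N' M' → Decomposition Γ m e b C u N N' M'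
retarget p refl refl R = record
  { inner = inner ; m≡ = m≡ ; e≡ = e≡ ; ctx≈ = ≈C-trans p ctx≈ ; refill = refill }
  where open Decomposition R

at-hole : ∀ {Γ m e u N N'} → Γ ⊢[ m , e ] u ∶ N → Decomposition Γ m e 0 (λ w → w) u N N' N'
at-hole {m = m} {e} D = record
  { Γout = ∅ ; inner = D ; m≡ = sym (+-identityʳ m) ; e≡ = sym (+-identityʳ e) ; ctx≈ = ≈C-refl
  ; refill = λ _ D' → castD (sym (+-identityʳ _)) (sym (+-identityʳ _)) D' }

app-layer : ∀ {Γ Π m e ma ea b C u s K N N' M'} → Decomposition Γ m e b C u N N' ((K ⇒ M') ∷ []) →
            Arg Π ma ea s K → Decomposition (Γ ⊎ Π) (suc (m + ma)) (e + ea) b (λ w → app (C w) s) u N N' M'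
app-layer {Π = Π} {ma = ma} {ea} {b} R arg = record
  { Γout = Γout ⊎ Π ; mC = suc (mC + ma) ; inner = inner
  ; m≡ = Eq.trans (cong suc (Eq.trans (cong (_+ ma) m≡) (+-assoc mu mC ma))) (sym (+-suc mu (mC + ma)))
  ; e≡ = Eq.trans (cong (_+ ea) e≡) (+-assoc eu eC ea)
  ; ctx≈ = λ k → ++-≈ˡ (Π k) (ctx≈ k) ⟫ ++-middle-swap (Γout k) (Δ (b + k)) (Π k)
  ; refill = λ {Θ} {m'} {e'} agree D' →
      castD (Eq.trans (cong suc (+-assoc m' mC ma)) (sym (+-suc m' (mC + ma)))) (+-assoc e' eC ea)
        (convC (app-arg (refill agree D') arg) (λ k → ++-middle-swap (Γout k) (Θ (b + k)) (Π k))) }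
  where open Decomposition R

es-layer : ∀ {Γ Π m e ma ea b C u s K N N' M'} → Decomposition (K ◂ Γ) m e b C u N N' M' →
           Arg Π ma ea s K → Decomposition (Γ ⊎ Π) (m + ma) (e + ea) (suc b) (λ w → es (C w) s) u N N' M'
es-layer {Π = Π} {ma = ma} {ea} {b} {K = K} R arg = record
  { Γout = λ k → Γout (suc k) ++ Π k ; inner = inner
  ; m≡ = Eq.trans (cong (_+ ma) m≡) (+-assoc mu mC ma) ; e≡ = Eq.trans (cong (_+ ea) e≡) (+-assoc eu eC ea)
  ; ctx≈ = λ k → ++-≈ˡ (Π k) (ctx≈ (suc k) ⟫ ++-≈ʳ (Γout (suc k)) (at Δ (+-suc b k)))
                 ⟫ ++-middle-swap (Γout (suc k)) (Δ (suc (b + k))) (Π k)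
  ; refill = λ {Θ} {m'} {e'} agree D' →
      castD (+-assoc m' mC ma) (+-assoc e' eC ea)
        (convC (es-arg (convC (refill (λ k k<b → agree k (m≤n⇒m≤1+n k<b)) D') (bind Θ agree)) arg)
               (λ k → ++-middle-swap (Γout (suc k)) (Θ (suc (b + k))) (Π k))) }
  where
  open Decomposition R
  bind : ∀ Θ → (∀ k → k < suc b → Θ k ≈M Δ k) →
         (Γout ⊎ dropC b Θ) ≈C (K ◂ ((λ k → Γout (suc k)) ⊎ dropC (suc b) Θ))
  bind Θ agree zero    = ++-≈ʳ (Γout zero) (at Θ (+-identityʳ b) ⟫ agree b ≤-refl ⟫ at Δ (sym (+-identityʳ b)))
                         ⟫ ≈M-sym (ctx≈ zero)
  bind Θ agree (suc k) = ++-≈ʳ (Γout (suc k)) (at Θ (+-suc b k))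

need-layer : ∀ {Γ Π mt et m e b C t u K M N N'} → (K ◂ Γ) ⊢[ mt , et ] t ∶ M → K ≢ 𝟎 →
             Decomposition Π m e b C u N N' K → Decomposition (Γ ⊎ Π) (mt + m) (et + e) b (λ w → es t (C w)) u N N' M
need-layer {Γ} {mt = mt} {et} {b = b} body K≢𝟎 R = record
  { Γout = Γ ⊎ Γout ; inner = inner
  ; m≡ = Eq.trans (cong (mt +_) m≡) (+-exchange mt mu mC) ; e≡ = Eq.trans (cong (et +_) e≡) (+-exchange et eu eC)
  ; ctx≈ = λ k → ++-≈ʳ (Γ k) (ctx≈ k) ⟫ ≈M-sym (++-assoc-≈ (Γ k) (Γout k) (Δ (b + k)))
  ; refill = λ {Θ} {m'} {e'} agree D' →
      castD (+-exchange mt m' mC) (+-exchange et e' eC)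
        (convC (es body (refill agree D') K≢𝟎) (λ k → ≈M-sym (++-assoc-≈ (Γ k) (Γout k) (Θ (b + k))))) }
  where
  open Decomposition R
  +-exchange : ∀ a b c → a + (b + c) ≡ b + (a + c)
  +-exchange = solve-∀

decompose-S : ∀ S {Γ m e w K} → Γ ⊢[ m , e ] plugS S w ∶ K → ∀ K' →
              Decomposition Γ m e (bS S) (plugS S) w K K' K'
decompose-S hole      D K' = at-hole D
decompose-S (sES S r) D K' = retarget ctx≈ m≡ e≡ (es-layer (decompose-S S body K') arg)
  where open ESView (es-view D)

-- At an occurrence of the variable bound around the context, the hole is
-- typed by an axiom, so the binder supplies the hole's type N (and more).
hole-variable : ∀ {Γ m e b C N N' M' K} (R : Decomposition (K ◂ Γ) m e b C (var b) N N' M') →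
                K ≈M (Decomposition.Γout R zero ++ N)
hole-variable {b = b} {N = N} R =
  ctx≈ zero ⟫ ++-≈ʳ (Γout zero) (at Δ (+-identityʳ b) ⟫ proj₂ (proj₂ (var-inversion inner)) b ⟫ ≡⇒≈M (↦-self b N))
  where open Decomposition R

-- hence a variable occurring in needed position cannot be bound by an erased ES
needed-variable-not-erased : ∀ {Γ m e b C N N' M'} → Decomposition (𝟎 ◂ Γ) m e b C (var b) N N' M' → N ≢ 𝟎 → ⊥
needed-variable-not-erased R N≢𝟎 = N≢𝟎 (proj₂ (𝟎≈++ (hole-variable R)))

NeededDecomposition : Ctx → ℕ → ℕ → ℕ → (Term → Term) → Term → MType → Set
NeededDecomposition Γ m e b C u M = Σ MType λ N → N ≢ 𝟎 × Decomposition Γ m e b C u N N M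

extend : ∀ {Γ Γ' m m' e e' b b' C C' u M M'} →
         (∀ {N} → Decomposition Γ' m' e' b' C' u N N M' → Decomposition Γ m e b C u N N M) →
         NeededDecomposition Γ' m' e' b' C' u M' → NeededDecomposition Γ m e b C u M
extend f (N , N≢𝟎 , R) = N , N≢𝟎 , f R

decompose-E : ∀ E {Γ m e u M} → Γ ⊢[ m , e ] plugE E u ∶ M → M ≢ 𝟎 →
              NeededDecomposition Γ m e (bE E) (plugE E) u M
decompose-E hole D M≢𝟎 = _ , M≢𝟎 , at-hole D
decompose-E (eapp E t) D _ =
  extend (λ R → retarget ctx≈ m≡ e≡ (app-layer R arg)) (decompose-E E head (λ ()))
  where open AppView (app-view D)
decompose-E (ees E t) D M≢𝟎 =
  extend (λ R → retarget ctx≈ m≡ e≡ (es-layer R arg)) (decompose-E E body M≢𝟎)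
  where open ESView (es-view D)
decompose-E (eneed E₁ E₂) {u = u} {M} D M≢𝟎 = extend (retarget ctx≈ m≡ e≡) (needed body arg)
  where
  open ESView (es-view D)
  -- the substitution binding the needed variable cannot be erased
  needed : ∀ {Γ Π K mt et ma ea} → (K ◂ Γ) ⊢[ mt , et ] plugE E₁ (var (bE E₁)) ∶ M →
           Arg Π ma ea (plugE E₂ u) K → NeededDecomposition (Γ ⊎ Π) (mt + ma) (et + ea) (bE E₂) (plugE (eneed E₁ E₂)) u M
  needed B (erased _) with decompose-E E₁ B M≢𝟎
  ... | _ , N≢𝟎 , R = ⊥-elim (needed-variable-not-erased R N≢𝟎)
  needed B (typed K≢𝟎 P) = extend (need-layer B K≢𝟎) (decompose-E E₂ P K≢𝟎)

-- The multiplicative root step.  Under S, an abstraction typed [N ⇒ M] and an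
-- argument of type N give t[x←s] : M; only the (app) rule's 1 is lost.
beta-under-S : ∀ S {Γ Π mG eG ma ea t s N M} → Γ ⊢[ mG , eG ] plugS S (lam t) ∶ ((N ⇒ M) ∷ []) →
               Arg Π ma ea s N → (Γ ⊎ Π) ⊢[ mG + ma , eG + ea ] plugS S (es t (wk (bS S) 0 s)) ∶ M
beta-under-S S {Γ} {Π} {ma = ma} {ea} {t} {s} {M = M} G A =
  castD (counters mu mC m≡ ma) (counters eu eC e≡ ea) (convC (refill agree reduct) ctx)
  where
  open Decomposition (decompose-S S G M)
  d = bS S
  -- the argument is moved under the d binders of S, in which it has no variables
  reduct : (Δ ⊎ pad d 0 Π) ⊢[ mu + ma , eu + ea ] es t (wk d 0 s) ∶ M
  reduct = es-arg (arrow-inversion inner (≈M-refl _)) (weaken-arg d A)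
  agree : ∀ k → k < d → (Δ ⊎ pad d 0 Π) k ≈M Δ k
  agree k k<d = ≡⇒≈M (Eq.trans (cong (Δ k ++_) (pad-below d Π k k<d)) (++-identityʳ (Δ k)))
  ctx : (Γout ⊎ dropC d (Δ ⊎ pad d 0 Π)) ≈C (Γ ⊎ Π)
  ctx k = ≈M-sym (++-assoc-≈ (Γout k) (Δ (d + k)) _) ⟫ ++-≈ (≈M-sym (ctx≈ k)) (≡⇒≈M (pad-above d Π k))
  counters : ∀ {n} a c → n ≡ a + c → ∀ x → (a + x) + c ≡ n + x
  counters a c refl x = +-swap a x c
    where
    +-swap : ∀ a x c → (a + x) + c ≡ (a + c) + x
    +-swap = solve-∀

m-root-step : ∀ S t s {Γ m e M} → Γ ⊢[ m , e ] app (plugS S (lam t)) s ∶ M →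
              Σ ℕ λ m' → m ≡ suc m' × Γ ⊢[ m' , e ] plugS S (es t (wk (bS S) 0 s)) ∶ M
m-root-step S t s D = mt + ms , m≡ , castD refl (sym e≡) (convC (beta-under-S S head arg) (≈C-sym ctx≈))
  where open AppView (app-view D)

weaken-redex-body : ∀ d E {Γ K m e M} → (K ◂ Γ) ⊢[ m , e ] plugE E (var (bE E)) ∶ M →
                    (K ◂ pad d 0 Γ) ⊢[ m , e ] plugE (wkE d 1 E) (var (bE (wkE d 1 E))) ∶ M
weaken-redex-body d E {Γ} {K} {m} {e} {M} B =
  subst₂ (λ Θ t → Θ ⊢[ m , e ] t ∶ M) (pad-above-◂ d K Γ) (wk-need-body d E) (weaken d 1 B)

-- In E⟨⟨x⟩⟩ typed under x : K, the occurrence of x consumes a part N ≠ 𝟎 of K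
-- and one exponential step; it can be replaced by any term v of type N
-- (moved under x and E), x keeping the remaining part A of K.
record HoleReplacement (Γ : Ctx) (K : MType) (m e : ℕ) (E : ECtx) (M : MType) : Set where
  field
    A N     : MType
    N≢𝟎     : N ≢ 𝟎
    K≈      : K ≈M (A ++ N)
    e-1     : ℕ
    e≡      : e ≡ suc e-1
    replace : ∀ {Π mv ev v} → Π ⊢[ mv , ev ] v ∶ N →
              (A ◂ (Γ ⊎ Π)) ⊢[ mv + m , ev + e-1 ] plugE E (wk (suc (bE E)) 0 v) ∶ M

replace-hole-variable : ∀ E {Γ K m e M} → (K ◂ Γ) ⊢[ m , e ] plugE E (var (bE E)) ∶ M → M ≢ 𝟎 →
                        HoleReplacement Γ K m e E M
replace-hole-variable E {Γ} D M≢𝟎 with decompose-E E D M≢𝟎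
... | N , N≢𝟎 , R with var-inversion (Decomposition.inner R)
... | mu≡0 , eu≡1 , Δ≈ = record
  { A = Γout zero ; N = N ; N≢𝟎 = N≢𝟎 ; K≈ = hole-variable R
  ; e-1 = eC ; e≡ = Eq.trans e≡ (cong (_+ eC) eu≡1)
  ; replace = λ {Π} {mv} P →
      castD (cong (mv +_) (sym (Eq.trans m≡ (cong (_+ mC) mu≡0)))) refl
        (convC (refill (agree Π) (weaken (suc b) 0 P)) (ctx Π)) }
  where
  open Decomposition R
  b = bE E
  -- Δ gives N to the hole variable and nothing to any other variable
  agree : ∀ Π k → k < b → pad (suc b) 0 Π k ≈M Δ k
  agree Π k k<b = ≡⇒≈M (pad-below (suc b) Π k (m≤n⇒m≤1+n k<b)) ⟫ ≈M-sym (Δ≈ k ⟫ ≡⇒≈M (↦-other b N k (<⇒≢ k<b)))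
  unused : ∀ k → Δ (b + suc k) ≈M 𝟎
  unused k = Δ≈ (b + suc k) ⟫ ≡⇒≈M (↦-other b N (b + suc k) (m+1+n≢m b))
  ctx : ∀ Π → (Γout ⊎ dropC b (pad (suc b) 0 Π)) ≈C (Γout zero ◂ (Γ ⊎ Π))
  ctx Π zero    = ≡⇒≈M (Eq.trans (cong (Γout zero ++_) (pad-below (suc b) Π (b + 0) (s≤s (≤-reflexive (+-identityʳ b)))))
                                 (++-identityʳ (Γout zero)))
  ctx Π (suc k) = ++-≈ (≡⇒≈M (sym (++-identityʳ _)) ⟫ ++-≈ʳ (Γout (suc k)) (≈M-sym (unused k)) ⟫ ≈M-sym (ctx≈ (suc k)))
                       (at (pad (suc b) 0 Π) (+-suc b k) ⟫ ≡⇒≈M (pad-above (suc b) Π k))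

e-contractum : ECtx → SCtx → Term → Term
e-contractum E S u = plugS S (es (plugE (wkE (bS S) 1 E) (wk (suc (bE E)) 0 (lam u))) (lam u))

-- E⟨⟨x⟩⟩[x←S⟨v⟩] ↦ S⟨E⟨⟨v⟩⟩[x←v]⟩: the type K of v splits into the part N
-- consumed by the occurrence of x and the part A kept by x; the copy of v
-- typed N replaces the occurrence, the rest types the new substitution.
e-step-under-S : ∀ E S {Γ Π mb eb mp ep u K M} → (K ◂ Γ) ⊢[ mb , eb ] plugE E (var (bE E)) ∶ M → M ≢ 𝟎 →
  Π ⊢[ mp , ep ] plugS S (lam u) ∶ K →
  Σ ℕ λ e' → eb + ep ≡ suc e' × (Γ ⊎ Π) ⊢[ mb + mp , e' ] e-contractum E S u ∶ M
e-step-under-S E S {Γ} {Π} {mb} {eb} {mp} {ep} {u} {M = M} B M≢𝟎 P =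
  _ , Eq.trans (cong (_+ ep) H.e≡) (cong suc (redistribute H.e-1 eC F.eA F.eB e≡ F.e≡)) ,
  castD (sym (redistribute mb mC F.mA F.mB m≡ F.m≡)) refl
    (convC (refill agree reduct) ctx)
  where
  open Decomposition (decompose-S S P M)
  d  = bS S
  E' = wkE d 1 E
  module H = HoleReplacement (replace-hole-variable E' (weaken-redex-body d E B) M≢𝟎)
  module F = FamilySplit (lam-split H.A H.N inner H.K≈)
  Reduct : ℕ → Set
  Reduct i = ((pad d 0 Γ ⊎ F.ΓB) ⊎ F.ΓA) ⊢[ (F.mB + mb) + F.mA , (F.eB + H.e-1) + F.eA ]
             es (plugE E' (wk (suc i) 0 (lam u))) (lam u) ∶ M
  reduct : Reduct (bE E)
  reduct = subst Reduct (bE-wkE d 1 E) (es-arg (H.replace (many H.N≢𝟎 F.right)) (family-arg F.left))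
  agree : ∀ k → k < d → ((pad d 0 Γ ⊎ F.ΓB) ⊎ F.ΓA) k ≈M Δ k
  agree k k<d = ++-≈ˡ (F.ΓA k) (++-≈ˡ (F.ΓB k) (≡⇒≈M (pad-below d Γ k k<d)))
                ⟫ ++-comm-≈ (F.ΓB k) (F.ΓA k) ⟫ ≈M-sym (F.ctx≈ k)
  ctx : (Γout ⊎ dropC d ((pad d 0 Γ ⊎ F.ΓB) ⊎ F.ΓA)) ≈C (Γ ⊎ Π)
  ctx k = ++-≈ʳ (Γout k) (++-≈ˡ (F.ΓA (d + k)) (++-≈ˡ (F.ΓB (d + k)) (≡⇒≈M (pad-above d Γ k))))
          ⟫ ++-≈ʳ (Γout k) (++-assoc-≈ (Γ k) _ _ ⟫ ++-≈ʳ (Γ k) (++-comm-≈ (F.ΓB (d + k)) (F.ΓA (d + k))))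
          ⟫ ++-exchange (Γout k) (Γ k) _
          ⟫ ++-≈ʳ (Γ k) (≈M-sym (ctx≈ k ⟫ ++-≈ʳ (Γout k) (F.ctx≈ (d + k))))
  redistribute : ∀ x {p v} c a n → p ≡ v + c → v ≡ a + n → x + p ≡ ((n + x) + a) + c
  redistribute x c a n refl refl = shuffle x c a n
    where
    shuffle : ∀ x c a n → x + ((a + n) + c) ≡ ((n + x) + a) + c
    shuffle = solve-∀

e-root-step : ∀ E S u {Γ m e M} → Γ ⊢[ m , e ] es (plugE E (var (bE E))) (plugS S (lam u)) ∶ M → M ≢ 𝟎 →
              Σ ℕ λ e' → e ≡ suc e' × Γ ⊢[ m , e' ] e-contractum E S u ∶ M
e-root-step E S u {M = M} D M≢𝟎 =
  let e' , e-1≡ , D' = step body arg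
  in  e' , Eq.trans e≡ e-1≡ , castD (sym m≡) refl (convC D' (≈C-sym ctx≈))
  where
  open ESView (es-view D)
  -- the substitution binding the needed variable cannot be erased
  step : ∀ {Γ Π K mb eb mp ep} → (K ◂ Γ) ⊢[ mb , eb ] plugE E (var (bE E)) ∶ M →
         Arg Π mp ep (plugS S (lam u)) K →
         Σ ℕ λ e' → eb + ep ≡ suc e' × (Γ ⊎ Π) ⊢[ mb + mp , e' ] e-contractum E S u ∶ M
  step B (erased _) = ⊥-elim (H.N≢𝟎 (proj₂ (𝟎≈++ H.K≈)))
    where module H = HoleReplacement (replace-hole-variable E B M≢𝟎)
  step B (typed _ P) = e-step-under-S E S B M≢𝟎 P

refill-hole : ∀ {Γ m e b C u N M m' e' u'} (R : Decomposition Γ m e b C u N N M) →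
              Decomposition.Δ R ⊢[ m' , e' ] u' ∶ N →
              Γ ⊢[ m' + Decomposition.mC R , e' + Decomposition.eC R ] C u' ∶ M
refill-hole R D' = convC (refill (λ _ _ → ≈M-refl _) D') (≈C-sym ctx≈)
  where open Decomposition R

lower : ∀ {n a'} a c → n ≡ a + c → a ≡ suc a' → 1 ≤ n × n ∸ 1 ≡ a' + c
lower a c refl refl = s≤s z≤n , refl

m-step : ∀ E {Γ m e t t' M} → Γ ⊢[ m , e ] plugE E t ∶ M → M ≢ 𝟎 → t ↦m t' →
         1 ≤ m × Γ ⊢[ m ∸ 1 , e ] plugE E t' ∶ M
m-step E D M≢𝟎 (root-m S t s) with decompose-E E D M≢𝟎
... | _ , _ , R with m-root-step S t s (Decomposition.inner R)
... | _ , mu≡ , D' with lower _ _ (Decomposition.m≡ R) mu≡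
... | 1≤m , m-1≡ = 1≤m , castD (sym m-1≡) (sym (Decomposition.e≡ R)) (refill-hole R D')

e-step : ∀ E {Γ m e t t' M} → Γ ⊢[ m , e ] plugE E t ∶ M → M ≢ 𝟎 → t ↦e t' →
         1 ≤ e × Γ ⊢[ m , e ∸ 1 ] plugE E t' ∶ M
e-step E D M≢𝟎 (root-e E₀ S u) with decompose-E E D M≢𝟎
... | _ , N≢𝟎 , R with e-root-step E₀ S u (Decomposition.inner R) N≢𝟎
... | _ , eu≡ , D' with lower _ _ (Decomposition.e≡ R) eu≡
... | 1≤e , e-1≡ = 1≤e , castD (sym (Decomposition.m≡ R)) (sym e-1≡) (refill-hole R D')

proposition10 : ∀ {Γ m e t M} → Γ ⊢[ m , e ] t ∶ M → M ≢ 𝟎 →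
    (∀ {s} → t →m-need s → 1 ≤ m × Γ ⊢[ m ∸ 1 , e ] s ∶ M) ×
    (∀ {s} → t →e-need s → 1 ≤ e × Γ ⊢[ m , e ∸ 1 ] s ∶ M)
proposition10 D M≢𝟎 = (λ { (ctx-m E r) → m-step E D M≢𝟎 r }) , (λ { (ctx-e E r) → e-step E D M≢𝟎 r })
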